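{- Let $G$ be a graph with finite star number $\sigma(G)\geq1$ and let $I$ be a directory of $G$. Then for any disjoint $S,T\subseteq I$ with $|S|=|T|=\sigma(G)$, there is no edge $v\sim w$ with $v\in K_S$ and $w\in K_T$.
   Context: Graphs are simple. $N(v)$ is the set of neighbours of $v$. $\alpha(H)$ is the supremum of sizes of independent sets of $H$. The star number is $\sigma(G)=\sup\{\alpha(N(v)):v\in G\}$ (finite here). A set $D$ dominates $X$ if $X\subseteq\bigcup_{d\in D}N(d)$; $D$ is a dominating set of $G$ if it dominates $G\setminus D$. A directory of $G$ is an independent dominating set $I$ of $G$ with $|I|=\alpha(G)$ if $\alpha(G)$ is finite, or $|I|\geq 2\sigma(G)-1$ if $\alpha(G)$ is infinite. For $S\subseteq I$, $K_S=\{v\in G: N(v)\cap I=S\}$. -}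

module Defs where

open import Data.Nat using (ℕ; _≤_; _≥_; _*_; _∸_)
open import Data.Product using (Σ; _×_; ∃)
open import Data.List using (List; length)
open import Data.List.Membership.Propositional using (_∈_; _∉_)
open import Data.List.Relation.Unary.All using (All)
open import Data.List.Relation.Unary.AllPairs using (AllPairs)
open import Data.List.Relation.Unary.Unique.Propositional using (Unique)
open import Relation.Binary.PropositionalEquality using (_≡_)
open import Relation.Nullary using (¬_)
open import Function.Bundles using (_⇔_)

record Graph : Set₁ where
  field
    V      : Set
    _~_    : V → V → Set
    ~-sym  : ∀ {x y} → x ~ y → y ~ x
    ~-irr  : ∀ {x} → ¬ (x ~ x)

module _ (G : Graph) where
  open Graph G

  VSet : Set₁
  VSet = V → Set

  N : V → VSet
  N v x = v ~ x

  Everything : VSet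
  Everything _ = V

  IndepList : VSet → List V → Set
  IndepList X xs = Unique xs × All X xs × AllPairs (λ x y → ¬ (x ~ y)) xs

  HasIndep : VSet → ℕ → Set
  HasIndep X k = Σ (List V) λ xs → IndepList X xs × length xs ≡ k

  AlphaIs : VSet → ℕ → Set
  AlphaIs X a = HasIndep X a × (∀ k → HasIndep X k → k ≤ a)

  AlphaInfinite : Set
  AlphaInfinite = ∀ n → HasIndep Everything n

  -- σ(G) = s: sup over v of α(N(v)) equals s (finite, hence attained)
  StarNumberIs : ℕ → Set
  StarNumberIs s = (∀ v k → HasIndep (N v) k → k ≤ s) × ∃ λ v → HasIndep (N v) s

  CardIs : VSet → ℕ → Set
  CardIs X a = Σ (List V) λ xs → Unique xs × length xs ≡ a × (∀ x → X x ⇔ x ∈ xs)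

  CardAtLeast : VSet → ℕ → Set
  CardAtLeast X k = Σ (List V) λ xs → Unique xs × All X xs × k ≤ length xs

  IsIndependent : VSet → Set
  IsIndependent X = ∀ x y → X x → X y → ¬ (x ~ y)

  IsDominating : VSet → Set
  IsDominating D = ∀ v → ¬ D v → ∃ λ d → D d × d ~ v

  -- Directory of G, relative to star number s = σ(G)
  IsDirectory : ℕ → VSet → Set
  IsDirectory s I =
    IsIndependent I × IsDominating I
    × (∀ a → AlphaIs Everything a → CardIs I a)
    × (AlphaInfinite → CardAtLeast I (2 * s ∸ 1))

  -- v ∈ K_S, i.e. N(v) ∩ I = S  (S a finite subset given as a list)
  InK : VSet → List V → V → Set
  InK I S v = ∀ x → (I x × v ~ x) ⇔ x ∈ S

-- S ⊆ N(v), since S ⊆ I and N(v) ∩ I = S; and S is independent as a subset of I.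
-- The vertex w is adjacent to v, it is not in I (it has a neighbour in T ≠ ∅ and
-- I is independent), and it has no neighbour in S (its neighbours in I lie in T,
-- which is disjoint from S). So S ∪ {w} is an independent set of size σ(G) + 1
-- inside N(v), which is impossible.
module Submission where

open import Defs
open import Data.Nat using (ℕ; _≥_; suc)
open import Data.Nat.Properties using (<-irrefl)
open import Data.List using (List; length; []; _∷_)
open import Data.List.Membership.Propositional using (_∈_; _∉_)
open import Data.List.Relation.Unary.All as All using (All; []; _∷_)
open import Data.List.Relation.Unary.Any using (here)
open import Data.List.Relation.Unary.AllPairs using (AllPairs; []; _∷_)
open import Data.List.Relation.Unary.Unique.Propositional using (Unique)
open import Data.Product using (_,_; proj₂)
open import Relation.Binary.PropositionalEquality using (_≡_; refl; sym; subst)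
open import Relation.Nullary using (¬_)
open import Function.Bundles using (Equivalence)

module _ (G : Graph) where
  open Graph G

  independent⇒allPairs-nonadjacent : ∀ {I} → IsIndependent G I →
    ∀ {xs} → All I xs → AllPairs (λ x y → ¬ (x ~ y)) xs
  independent⇒allPairs-nonadjacent indI []         = []
  independent⇒allPairs-nonadjacent indI (ix ∷ ixs) =
    All.map (indI _ _ ix) ixs ∷ independent⇒allPairs-nonadjacent indI ixs

  indepList-∷ : ∀ {X x xs} → X x → x ∉ xs → All (λ y → ¬ (x ~ y)) xs →
    IndepList G X xs → IndepList G X (x ∷ xs)
  indepList-∷ Xx x∉xs x≁xs (uxs , Xxs , pxs) =
    ( All.tabulate (λ y∈xs x≡y → x∉xs (subst (_∈ _) (sym x≡y) y∈xs)) ∷ uxs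
    , Xx ∷ Xxs
    , x≁xs ∷ pxs )

  module _ {I : VSet G} where

    inK⇒⊆N : ∀ {S v} → InK G I S v → All (N G v) S
    inK⇒⊆N kv = All.tabulate (λ y∈S → proj₂ (Equivalence.from (kv _) y∈S))

    inK-nonempty⇒∉I : IsIndependent G I → ∀ {T w} → length T ≥ 1 → All I T →
      InK G I T w → ¬ I w
    inK-nonempty⇒∉I indI {[]}    ()
    inK-nonempty⇒∉I indI {_ ∷ _} _ (It ∷ _) kw Iw =
      indI _ _ Iw It (proj₂ (Equivalence.from (kw _) (here refl)))

    inK⇒nonadjacent-outside : ∀ {T w S} → All I S → (∀ x → x ∈ S → x ∉ T) →
      InK G I T w → All (λ y → ¬ (w ~ y)) S
    inK⇒nonadjacent-outside IS disj kw =
      All.tabulate (λ y∈S w~y →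
        disj _ y∈S (Equivalence.to (kw _) (All.lookup IS y∈S , w~y)))

proposition14 : (G : Graph) → (s : ℕ) → StarNumberIs G s → s ≥ 1
    → (I : Graph.V G → Set) → IsDirectory G s I
    → (S T : List (Graph.V G))
    → Unique S → All I S → length S ≡ s
    → Unique T → All I T → length T ≡ s
    → (∀ x → x ∈ S → x ∉ T)
    → ∀ v w → InK G I S v → InK G I T w → ¬ (Graph._~_ G v w)
proposition14 G s (σ-bound , _) s≥1 I (indI , _) S T uS IS refl _ IT lT disj v w kv kw v~w =
  <-irrefl refl (σ-bound v (suc (length S)) (w ∷ S , S∪w-indep , refl))
  where
  w∉I : ¬ I w
  w∉I = inK-nonempty⇒∉I G indI (subst (_≥ 1) (sym lT) s≥1) IT kw

  S∪w-indep : IndepList G (N G v) (w ∷ S)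
  S∪w-indep = indepList-∷ G v~w (λ w∈S → w∉I (All.lookup IS w∈S))
    (inK⇒nonadjacent-outside G IS disj kw)
    (uS , inK⇒⊆N G kv , independent⇒allPairs-nonadjacent G indI IS)
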